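{- For the name-generation monad $T$ on $[\mathsf{Inj},\mathsf{Set}]$, the sober objects are precisely the nominal sets (the pullback-preserving functors $\mathsf{Inj}\to\mathsf{Set}$), and the associated sobrification monad $D$ is idempotent.
   Context: $\mathsf{Inj}$ is the category of finite sets and injections, $a+b$ disjoint union. The name-generation monad is $(TX)a=\mathrm{colim}_{b\in\mathsf{Inj}}X(a+b)$, elements being classes $[b,x]$ with $x\in X(a+b)$ and $[b,x]=[b',X(1_a+f)(x)]$ for injections $f:b\to b'$; unit $\eta(x)=[\emptyset,x]$, multiplication $[b,[c,x]]\mapsto[b+c,x]$. An object $X$ is sober for $T$ if its unit fork $X\xrightarrow{\eta_X}TX\rightrightarrows TTX$ (parallel pair $\eta_{TX},T\eta_X$) is an equalizer. $D$ is the monad on $[\mathsf{Inj},\mathsf{Set}]$ with $\theta_X:DX\to TX$ the equalizer of $\eta_{TX},T\eta_X$, induced by the bijection between morphisms $X\to DY$ and thunkable Kleisli morphisms $X\rightsquigarrow Y$ (maps $f^\sharp:X\to TY$ with $\eta_{TY}\circ f^\sharp=T\eta_Y\circ f^\sharp$); its unit $e_X$ satisfies $\theta_X\circ e_X=\eta_X$. $D$ is idempotent if its multiplication $DD\Rightarrow D$ is an isomorphism. -}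

module Defs where

open import Level using (0ℓ)
open import Data.Nat using (ℕ; zero; suc; _+_)
open import Data.Nat.Properties using (+-assoc)
open import Data.Fin using (Fin; splitAt; join)
open import Data.Fin.Properties using (splitAt-join; join-splitAt)
open import Data.Sum using (_⊎_; inj₁; inj₂)
import Data.Sum as Sum
open import Data.Product using (Σ; _×_; _,_; proj₁; proj₂)
open import Function using (_∘_; id)
open import Function.Definitions using (Injective)
open import Relation.Binary using (Setoid; Rel)
open import Relation.Binary.PropositionalEquality
  using (_≡_; refl; cong; sym; trans; subst)
open import Relation.Binary.Construct.Closure.Equivalence using (EqClosure)
import Relation.Binary.Construct.Closure.Equivalence as EqC
import Relation.Binary.Construct.On as On

-- The category Inj (skeleton: objects n ∈ ℕ standing for Fin n,
-- morphisms = injective functions, equality of morphisms = pointwise).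

record Inj (a b : ℕ) : Set where
  constructor mkInj
  field
    fun : Fin a → Fin b
    inj : Injective _≡_ _≡_ fun
open Inj public

idInj : ∀ {a} → Inj a a
idInj = mkInj id id

_∘ᵢ_ : ∀ {a b c} → Inj b c → Inj a b → Inj a c
g ∘ᵢ f = mkInj (fun g ∘ fun f) (inj f ∘ inj g)

_≗ᵢ_ : ∀ {a b} → Inj a b → Inj a b → Set
f ≗ᵢ g = ∀ i → fun f i ≡ fun g i

-- Disjoint union: the coproduct b + a of the paper's "a + b" is
-- represented by Fin (b + a), the (fresh) summand b coming first.
private
  map-inj : ∀ {A B C D : Set} {f : A → C} {g : B → D} →
            Injective _≡_ _≡_ f → Injective _≡_ _≡_ g →
            Injective _≡_ _≡_ (Sum.map f g)
  map-inj fi gi {inj₁ x} {inj₁ y} p = cong inj₁ (fi (lem₁ p))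
    where lem₁ : ∀ {A B : Set} {u v : A} → inj₁ {B = B} u ≡ inj₁ v → u ≡ v
          lem₁ refl = refl
  map-inj fi gi {inj₁ x} {inj₂ y} ()
  map-inj fi gi {inj₂ x} {inj₁ y} ()
  map-inj fi gi {inj₂ x} {inj₂ y} p = cong inj₂ (gi (lem₂ p))
    where lem₂ : ∀ {A B : Set} {u v : B} → inj₂ {A = A} u ≡ inj₂ v → u ≡ v
          lem₂ refl = refl

_⊕_ : ∀ {b b' a a'} → Inj b b' → Inj a a' → Inj (b + a) (b' + a')
_⊕_ {b} {b'} {a} {a'} f g = mkInj h h-inj
  where
  h : Fin (b + a) → Fin (b' + a')
  h = join b' a' ∘ Sum.map (fun f) (fun g) ∘ splitAt b
  h-inj : Injective _≡_ _≡_ h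
  h-inj {i} {j} p =
    trans (sym (join-splitAt b a i))
      (trans (cong (join b a)
                (map-inj (inj f) (inj g) {splitAt b i} {splitAt b j}
                  (trans (sym (splitAt-join b' a' _))
                    (trans (cong (splitAt b') p) (splitAt-join b' a' _)))))
             (join-splitAt b a j))

-- Functors Inj → Set, with sets presented as setoids (Set-quotients
-- such as colimits are thereby available).

record Functor : Set₁ where
  field
    Obj    : ℕ → Setoid 0ℓ 0ℓ
  C : ℕ → Set
  C a = Setoid.Carrier (Obj a)
  _≈_ : ∀ {a} → C a → C a → Set
  _≈_ {a} x y = Setoid._≈_ (Obj a) x y
  field
    act    : ∀ {a b} → Inj a b → C a → C b
    act-cong : ∀ {a b} (f : Inj a b) {x y : C a} → x ≈ y → act f x ≈ act f y
    act-ext  : ∀ {a b} {f g : Inj a b} → f ≗ᵢ g → ∀ x → act f x ≈ act g x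
    act-id   : ∀ {a} (x : C a) → act idInj x ≈ x
    act-∘    : ∀ {a b c} (g : Inj b c) (f : Inj a b) (x : C a) →
               act (g ∘ᵢ f) x ≈ act g (act f x)

-- A presheaf-like family where the action is given as a (functional)
-- relation "Act f x y  ⇔  X(f) x = y".  Used only to *compute* the
-- name-generation monad T on functors and on their subfunctors (DX).
record RFam : Set₁ where
  field
    Obj : ℕ → Setoid 0ℓ 0ℓ
  C : ℕ → Set
  C a = Setoid.Carrier (Obj a)
  field
    Act : ∀ {a a'} → Inj a a' → C a → C a' → Set

toR : Functor → RFam
toR X = record { Obj = Functor.Obj X
               ; Act = λ {a} {a'} f x y → Setoid._≈_ (Functor.Obj X a') (Functor.act X f x) y }

-- The name-generation monad T.
-- (T Y) a = colim_{b ∈ Inj} Y (b + a): pairs [b , y], y ∈ Y (b + a),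
-- quotiented by the equivalence relation generated by
-- [b , y] ~ [b' , Y(f ⊕ 1_a) y]  for injections f : b → b'.

module _ (Y : RFam) where
  open RFam Y

  TCar : ℕ → Set
  TCar a = Σ ℕ λ b → C (b + a)

  TGen : ∀ a → Rel (TCar a) 0ℓ
  TGen a (b , y) (b' , y') = Σ (Inj b b') λ f → Act (f ⊕ idInj {a}) y y'

  TEq : ∀ a → Rel (TCar a) 0ℓ
  TEq a = EqClosure (TGen a)

T : RFam → RFam
T Y = record
  { Obj = λ a → EqC.setoid (TGen Y a)
  ; Act = λ {a} {a'} g → λ { (c , y) (c' , y') →
      Σ (RFam.C Y (c + a')) λ y'' →
        RFam.Act Y (idInj {c} ⊕ g) y y'' × TEq Y a' (c , y'') (c' , y') }
  }

η : (Y : RFam) → ∀ {a} → RFam.C Y a → RFam.C (T Y) a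
η Y y = (0 , y)

Tη : (Y : RFam) → ∀ {a} → RFam.C (T Y) a → RFam.C (T (T Y)) a
Tη Y (b , y) = (b , η Y y)

μT : (Y : RFam) → ∀ {a} → RFam.C (T (T Y)) a → RFam.C (T Y) a
μT Y {a} (b , (c , x)) =
  (c + b , subst (RFam.C Y) (sym (+-assoc c b a)) x)

Thunkable : (Y : RFam) → ∀ {a} → RFam.C (T Y) a → Set
Thunkable Y {a} t = Setoid._≈_ (RFam.Obj (T (T Y)) a) (η (T Y) t) (Tη Y t)

-- The sobrification monad D: θ_Y : D Y → T Y is the equalizer of
-- η_{TY}, Tη_Y (a subfunctor of T Y).

D : RFam → RFam
D Y = record
  { Obj = λ a → On.setoid {B = Σ (RFam.C (T Y) a) (Thunkable Y)}
                  (RFam.Obj (T Y) a) proj₁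
  ; Act = λ f d d' → RFam.Act (T Y) f (proj₁ d) (proj₁ d')
  }

θ : (Y : RFam) → ∀ {a} → RFam.C (D Y) a → RFam.C (T Y) a
θ Y = proj₁

e : (Y : RFam) → ∀ {a} → RFam.C Y a → RFam.C (D Y) a
e Y y = (η Y y , Setoid.refl (RFam.Obj (T (T Y)) _))

Tθ : (Y : RFam) → ∀ {a} → RFam.C (T (D Y)) a → RFam.C (T (T Y)) a
Tθ Y (b , d) = (b , θ Y d)

-- The underlying map of the multiplication of D:  DDY → DY is the
-- unique map with  θ_Y ∘ μᴰ = μᵀ_Y ∘ Tθ_Y ∘ θ_{DY}.
μD-underlying : (Y : RFam) → ∀ {a} → RFam.C (D (D Y)) a → RFam.C (T Y) a
μD-underlying Y s = μT Y (Tθ Y (θ (D Y) s))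

-- D is idempotent at Y: μᴰ_Y : DDY → DY is well defined (its values
-- are in DY) and is a bijection at every stage a.
DIdempotentAt : RFam → Set
DIdempotentAt Y = ∀ a →
    (∀ (s : RFam.C (D (D Y)) a) → Thunkable Y (μD-underlying Y s))
  × (∀ (s s' : RFam.C (D (D Y)) a) →
       Setoid._≈_ (RFam.Obj (T Y) a) (μD-underlying Y s) (μD-underlying Y s') →
       Setoid._≈_ (RFam.Obj (D (D Y)) a) s s')
  × (∀ (d : RFam.C (D Y) a) → Σ (RFam.C (D (D Y)) a) λ s →
       Setoid._≈_ (RFam.Obj (T Y) a) (μD-underlying Y s) (θ Y d))

-- Sober: the fork X → TX ⇉ TTX is an equalizer (limits in [Inj,Set]
-- are pointwise; an equalizer in Set is an injection onto the
-- equalized subset).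

Sober : Functor → Set
Sober X =
    (∀ {a} (x y : RFam.C Y a) →
       Setoid._≈_ (RFam.Obj (T Y) a) (η Y x) (η Y y) → Setoid._≈_ (RFam.Obj Y a) x y)
  × (∀ {a} (t : RFam.C (T Y) a) → Thunkable Y t →
       Σ (RFam.C Y a) λ x → Setoid._≈_ (RFam.Obj (T Y) a) (η Y x) t)
  where Y = toR X

IsPullbackInj : ∀ {a b c d} → Inj a c → Inj b c → Inj d a → Inj d b → Set
IsPullbackInj {a} {b} {c} {d} f g p q =
    ((f ∘ᵢ p) ≗ᵢ (g ∘ᵢ q))
  × (∀ {e} (p' : Inj e a) (q' : Inj e b) → (f ∘ᵢ p') ≗ᵢ (g ∘ᵢ q') →
       Σ (Inj e d) λ u → ((p ∘ᵢ u) ≗ᵢ p') × ((q ∘ᵢ u) ≗ᵢ q')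
         × (∀ (u' : Inj e d) → (p ∘ᵢ u') ≗ᵢ p' → (q ∘ᵢ u') ≗ᵢ q' → u' ≗ᵢ u))

IsPullbackImage : (X : Functor) → ∀ {a b c d} →
                  Inj a c → Inj b c → Inj d a → Inj d b → Set
IsPullbackImage X {a} {b} {c} {d} f g p q =
    (∀ (z : C d) → act f (act p z) ≈ act g (act q z))
  × (∀ (x : C a) (y : C b) → act f x ≈ act g y →
       Σ (C d) λ z → (act p z ≈ x) × (act q z ≈ y)
         × (∀ (z' : C d) → act p z' ≈ x → act q z' ≈ y → z' ≈ z))
  where open Functor X

Nominal : Functor → Set
Nominal X = ∀ {a b c d} (f : Inj a c) (g : Inj b c) (p : Inj d a) (q : Inj d b) →
            IsPullbackInj f g p q → IsPullbackImage X f g p q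

{-# OPTIONS --safe #-}
-- Amalgamating injections shows that two representatives [b , y] and [b' , y'] of an
-- element of T X are equal iff they agree after embedding b and b' into one common set
-- of fresh names.  Hence [b , w] is thunkable iff w is unchanged when its b fresh names
-- are moved into two disjoint blocks.  If X preserves pullbacks, the pullback of these
-- two injections b + a → N is a itself, so w comes from X a and X is sober.  Conversely,
-- for sober X every X f is injective, and given f x = g y over a pullback square (p , q),
-- turning the names of x outside the image of p into fresh ones gives a thunkable
-- element of T X d whose η-preimage is the mediating element.  For idempotence of D,
-- [b , [c , x]] = [c + b , e x] in T (D X), since the fresh names of the thunkable
-- [c , x] may be bound outside; this makes μ injective, carries thunkability from
-- D D X to μ s, and [∅ , d] is a preimage of d.
module Submission where

open import Defs
open import Data.Product using (_×_)
open import Function.Bundles using (_⇔_)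

open import Data.Nat using (ℕ; _+_)
open import Data.Nat.Properties using (+-assoc; +-identityʳ)
open import Data.Fin using (Fin; zero; splitAt; join; _↑ˡ_; _↑ʳ_; toℕ; _≟_)
open import Data.Fin.Properties
  using (join-splitAt; splitAt-↑ˡ; splitAt-↑ʳ; ↑ˡ-injective; ↑ʳ-injective;
         toℕ-↑ˡ; toℕ-↑ʳ; toℕ-injective; any?)
open import Data.Sum using (_⊎_; inj₁; inj₂)
import Data.Sum as Sum
open import Data.Product using (Σ; _,_; proj₁; proj₂)
open import Data.Empty using (⊥-elim)
open import Function using (_∘_)
open import Function.Bundles using (mk⇔)
open import Function.Definitions using (Injective)
open import Relation.Binary using (Setoid)
open import Relation.Binary.PropositionalEquality
  using (_≡_; _≢_; refl; cong; sym; trans; subst; module ≡-Reasoning)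
open import Relation.Nullary using (Dec; yes; no)
import Relation.Binary.Construct.Closure.Equivalence as EqC
open import Relation.Binary.Construct.Closure.ReflexiveTransitive using (ε; _◅_; _◅◅_)
open import Relation.Binary.Construct.Closure.Symmetric using (fwd; bwd)

↑ˡ≢↑ʳ : ∀ {m n} (i : Fin m) (j : Fin n) → i ↑ˡ n ≢ m ↑ʳ j
↑ˡ≢↑ʳ {m} {n} i j eq
  with trans (sym (splitAt-↑ˡ m i n)) (trans (cong (splitAt m) eq) (splitAt-↑ʳ m n j))
... | ()

↑-view : ∀ m n (k : Fin (m + n)) →
         (Σ (Fin m) λ i → k ≡ i ↑ˡ n) ⊎ (Σ (Fin n) λ j → k ≡ m ↑ʳ j)
↑-view m n k with splitAt m k | join-splitAt m n k
... | inj₁ i | eq = inj₁ (i , sym eq)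
... | inj₂ j | eq = inj₂ (j , sym eq)

↑-ext : ∀ {m n} {A : Set} (F G : Fin (m + n) → A) →
        (∀ i → F (i ↑ˡ n) ≡ G (i ↑ˡ n)) → (∀ j → F (m ↑ʳ j) ≡ G (m ↑ʳ j)) →
        ∀ k → F k ≡ G k
↑-ext {m} {n} F G left right k with ↑-view m n k
... | inj₁ (i , refl) = left i
... | inj₂ (j , refl) = right j

inlᵢ : ∀ {m} n → Inj m (m + n)
inlᵢ n = mkInj (_↑ˡ n) (↑ˡ-injective n _ _)

inrᵢ : ∀ m {n} → Inj n (m + n)
inrᵢ m = mkInj (m ↑ʳ_) (↑ʳ-injective m _ _)

!ᵢ : ∀ {m} → Inj 0 m
!ᵢ = mkInj (λ ()) (λ { {()} })

substᵢ : ∀ {n m} → n ≡ m → Inj n m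
substᵢ refl = idInj

toℕ-substᵢ : ∀ {n m} (p : n ≡ m) (i : Fin n) → toℕ (fun (substᵢ p) i) ≡ toℕ i
toℕ-substᵢ refl i = refl

+-assocᵢ : ∀ x y z → Inj (x + (y + z)) ((x + y) + z)
+-assocᵢ x y z = substᵢ (sym (+-assoc x y z))

+-assocᵢ-↑ˡ : ∀ x y z (i : Fin x) → fun (+-assocᵢ x y z) (i ↑ˡ (y + z)) ≡ (i ↑ˡ y) ↑ˡ z
+-assocᵢ-↑ˡ x y z i = toℕ-injective (begin
  toℕ (fun (+-assocᵢ x y z) (i ↑ˡ (y + z))) ≡⟨ toℕ-substᵢ (sym (+-assoc x y z)) _ ⟩
  toℕ (i ↑ˡ (y + z))                        ≡⟨ toℕ-↑ˡ i (y + z) ⟩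
  toℕ i                                     ≡⟨ toℕ-↑ˡ i y ⟨
  toℕ (i ↑ˡ y)                              ≡⟨ toℕ-↑ˡ (i ↑ˡ y) z ⟨
  toℕ ((i ↑ˡ y) ↑ˡ z)                       ∎)
  where open ≡-Reasoning

+-assocᵢ-↑ʳ↑ˡ : ∀ x y z (j : Fin y) → fun (+-assocᵢ x y z) (x ↑ʳ (j ↑ˡ z)) ≡ (x ↑ʳ j) ↑ˡ z
+-assocᵢ-↑ʳ↑ˡ x y z j = toℕ-injective (begin
  toℕ (fun (+-assocᵢ x y z) (x ↑ʳ (j ↑ˡ z))) ≡⟨ toℕ-substᵢ (sym (+-assoc x y z)) _ ⟩
  toℕ (x ↑ʳ (j ↑ˡ z))                        ≡⟨ toℕ-↑ʳ x (j ↑ˡ z) ⟩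
  x + toℕ (j ↑ˡ z)                           ≡⟨ cong (x +_) (toℕ-↑ˡ j z) ⟩
  x + toℕ j                                  ≡⟨ toℕ-↑ʳ x j ⟨
  toℕ (x ↑ʳ j)                               ≡⟨ toℕ-↑ˡ (x ↑ʳ j) z ⟨
  toℕ ((x ↑ʳ j) ↑ˡ z)                        ∎)
  where open ≡-Reasoning

+-assocᵢ-↑ʳ↑ʳ : ∀ x y z (k : Fin z) → fun (+-assocᵢ x y z) (x ↑ʳ (y ↑ʳ k)) ≡ (x + y) ↑ʳ k
+-assocᵢ-↑ʳ↑ʳ x y z k = toℕ-injective (begin
  toℕ (fun (+-assocᵢ x y z) (x ↑ʳ (y ↑ʳ k))) ≡⟨ toℕ-substᵢ (sym (+-assoc x y z)) _ ⟩
  toℕ (x ↑ʳ (y ↑ʳ k))                        ≡⟨ toℕ-↑ʳ x (y ↑ʳ k) ⟩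
  x + toℕ (y ↑ʳ k)                           ≡⟨ cong (x +_) (toℕ-↑ʳ y k) ⟩
  x + (y + toℕ k)                            ≡⟨ +-assoc x y (toℕ k) ⟨
  (x + y) + toℕ k                            ≡⟨ toℕ-↑ʳ (x + y) k ⟨
  toℕ ((x + y) ↑ʳ k)                         ∎)
  where open ≡-Reasoning

⊕-↑ˡ : ∀ {b b' a a'} (f : Inj b b') (g : Inj a a') (i : Fin b) →
       fun (f ⊕ g) (i ↑ˡ a) ≡ fun f i ↑ˡ a'
⊕-↑ˡ {b} {b'} {a} {a'} f g i =
  cong (join b' a' ∘ Sum.map (fun f) (fun g)) (splitAt-↑ˡ b i a)

⊕-↑ʳ : ∀ {b b' a a'} (f : Inj b b') (g : Inj a a') (j : Fin a) →
       fun (f ⊕ g) (b ↑ʳ j) ≡ b' ↑ʳ fun g j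
⊕-↑ʳ {b} {b'} {a} {a'} f g j =
  cong (join b' a' ∘ Sum.map (fun f) (fun g)) (splitAt-↑ʳ b a j)

⊕-∘ : ∀ {b b' b'' a a' a''} (g : Inj b' b'') (h : Inj a' a'') (g' : Inj b b') (h' : Inj a a') →
      ((g ⊕ h) ∘ᵢ (g' ⊕ h')) ≗ᵢ ((g ∘ᵢ g') ⊕ (h ∘ᵢ h'))
⊕-∘ {b} {a = a} g h g' h' = ↑-ext {b} {a} _ _
  (λ i → trans (cong (fun (g ⊕ h)) (⊕-↑ˡ g' h' i))
           (trans (⊕-↑ˡ g h _) (sym (⊕-↑ˡ (g ∘ᵢ g') (h ∘ᵢ h') i))))
  (λ j → trans (cong (fun (g ⊕ h)) (⊕-↑ʳ g' h' j))
           (trans (⊕-↑ʳ g h _) (sym (⊕-↑ʳ (g ∘ᵢ g') (h ∘ᵢ h') j))))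

⊕-cong : ∀ {b b' a a'} {g g' : Inj b b'} {h h' : Inj a a'} →
         g ≗ᵢ g' → h ≗ᵢ h' → (g ⊕ h) ≗ᵢ (g' ⊕ h')
⊕-cong {b} {a = a} {g = g} {g'} {h} {h'} g≗g' h≗h' = ↑-ext {b} {a} _ _
  (λ i → trans (⊕-↑ˡ g h i) (trans (cong (_↑ˡ _) (g≗g' i)) (sym (⊕-↑ˡ g' h' i))))
  (λ j → trans (⊕-↑ʳ g h j) (trans (cong (_ ↑ʳ_) (h≗h' j)) (sym (⊕-↑ʳ g' h' j))))

⊕-id : ∀ {b a} → (idInj {b} ⊕ idInj {a}) ≗ᵢ idInj
⊕-id {b} {a} = ↑-ext {b} {a} _ _ (⊕-↑ˡ idInj idInj) (⊕-↑ʳ idInj idInj)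

⊕-interchange : ∀ {c c' a a'} (f : Inj c c') (g : Inj a a') →
                ((f ⊕ idInj {a'}) ∘ᵢ (idInj {c} ⊕ g)) ≗ᵢ ((idInj {c'} ⊕ g) ∘ᵢ (f ⊕ idInj {a}))
⊕-interchange {c} {a = a} f g = ↑-ext {c} {a} _ _
  (λ i → trans (⊕-∘ f idInj idInj g (i ↑ˡ _)) (sym (⊕-∘ idInj g f idInj (i ↑ˡ _))))
  (λ j → trans (⊕-∘ f idInj idInj g (_ ↑ʳ j)) (sym (⊕-∘ idInj g f idInj (_ ↑ʳ j))))

substᵢ-⊕ : ∀ {c c' a} (p : c ≡ c') (q : c + a ≡ c' + a) →
           (substᵢ p ⊕ idInj {a}) ≗ᵢ substᵢ q
substᵢ-⊕ {c} {a = a} refl q k =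
  toℕ-injective (trans (cong toℕ (⊕-id {c} {a} k)) (sym (toℕ-substᵢ q k)))

+-assocᵢ-↑ʳ : ∀ c b a (j : Fin (b + a)) →
              fun (+-assocᵢ c b a) (c ↑ʳ j) ≡ fun (inrᵢ c ⊕ idInj {a}) j
+-assocᵢ-↑ʳ c b a = ↑-ext {b} {a} _ _
  (λ l → trans (+-assocᵢ-↑ʳ↑ˡ c b a l) (sym (⊕-↑ˡ (inrᵢ c) (idInj {a}) l)))
  (λ k → trans (+-assocᵢ-↑ʳ↑ʳ c b a k) (sym (⊕-↑ʳ (inrᵢ c) (idInj {a}) k)))

-- amalg ∘ᵢ u ≗ᵢ inrᵢ m ∘ᵢ v, so (amalg , inrᵢ m) completes the span (u , v) to a
-- commuting square; this is what shortens zigzags of renamings to cospans.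
module Amalgamation {n m p} (u : Inj n m) (v : Inj n p) where
  image? : (k : Fin m) → Dec (Σ (Fin n) λ i → fun u i ≡ k)
  image? k = any? (λ i → fun u i ≟ k)

  private
    amalg-fun : Fin m → Fin (m + p)
    amalg-fun k with image? k
    ... | yes (i , _) = m ↑ʳ fun v i
    ... | no _ = k ↑ˡ p

    amalg-injective : Injective _≡_ _≡_ amalg-fun
    amalg-injective {k} {k'} eq with image? k | image? k'
    ... | yes (i , ui≡k) | yes (i' , ui'≡k') =
      trans (sym ui≡k) (trans (cong (fun u) (inj v (↑ʳ-injective m _ _ eq))) ui'≡k')
    ... | yes _ | no _ = ⊥-elim (↑ˡ≢↑ʳ _ _ (sym eq))
    ... | no _ | yes _ = ⊥-elim (↑ˡ≢↑ʳ _ _ eq)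
    ... | no _ | no _ = ↑ˡ-injective p _ _ eq

  amalg : Inj m (m + p)
  amalg = mkInj amalg-fun amalg-injective

  amalg-image : ∀ i → fun amalg (fun u i) ≡ m ↑ʳ fun v i
  amalg-image i with image? (fun u i)
  ... | yes (i' , ui'≡ui) = cong (λ j → m ↑ʳ fun v j) (inj u ui'≡ui)
  ... | no ∉image = ⊥-elim (∉image (i , refl))

  amalg-outside : ∀ k → (∀ i → fun u i ≢ k) → fun amalg k ≡ k ↑ˡ p
  amalg-outside k ∉image with image? k
  ... | yes (i , ui≡k) = ⊥-elim (∉image i ui≡k)
  ... | no _ = refl

record IsFunctorial (R : RFam) : Set₁ where
  field
    act      : ∀ {a b} → Inj a b → RFam.C R a → RFam.C R b
    act-cong : ∀ {a b} (f : Inj a b) {x y : RFam.C R a} →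
               Setoid._≈_ (RFam.Obj R a) x y → Setoid._≈_ (RFam.Obj R b) (act f x) (act f y)
    act-ext  : ∀ {a b} {f g : Inj a b} → f ≗ᵢ g → ∀ x →
               Setoid._≈_ (RFam.Obj R b) (act f x) (act g x)
    act-id   : ∀ {a} (x : RFam.C R a) → Setoid._≈_ (RFam.Obj R a) (act idInj x) x
    act-∘    : ∀ {a b c} (g : Inj b c) (f : Inj a b) (x : RFam.C R a) →
               Setoid._≈_ (RFam.Obj R c) (act (g ∘ᵢ f) x) (act g (act f x))
    Act⇒act≈ : ∀ {a b} (f : Inj a b) {x y} → RFam.Act R f x y →
               Setoid._≈_ (RFam.Obj R b) (act f x) y
    act≈⇒Act : ∀ {a b} (f : Inj a b) {x y} → Setoid._≈_ (RFam.Obj R b) (act f x) y →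
               RFam.Act R f x y

functor-isFunctorial : (X : Functor) → IsFunctorial (toR X)
functor-isFunctorial X = record
  { act = Functor.act X ; act-cong = Functor.act-cong X ; act-ext = Functor.act-ext X
  ; act-id = Functor.act-id X ; act-∘ = Functor.act-∘ X
  ; Act⇒act≈ = λ _ e → e ; act≈⇒Act = λ _ e → e }

module Functorial {R : RFam} (ρ : IsFunctorial R) where
  open IsFunctorial ρ public
  module S {a} = Setoid (RFam.Obj R a)

  _≈_ : ∀ {a} → RFam.C R a → RFam.C R a → Set
  _≈_ {a} = Setoid._≈_ (RFam.Obj R a)

  act-≗∘ : ∀ {a b c} {h : Inj a c} (g : Inj b c) (f : Inj a b) → h ≗ᵢ (g ∘ᵢ f) → ∀ x →
           act h x ≈ act g (act f x)
  act-≗∘ g f h≗g∘f x = S.trans (act-ext h≗g∘f x) (act-∘ g f x)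

  act-square : ∀ {a b b' c} (g : Inj b c) (f : Inj a b) (g' : Inj b' c) (f' : Inj a b') →
               (g ∘ᵢ f) ≗ᵢ (g' ∘ᵢ f') → ∀ x → act g (act f x) ≈ act g' (act f' x)
  act-square g f g' f' square x =
    S.trans (S.sym (act-∘ g f x)) (act-≗∘ g' f' square x)

  act-∘₃ : ∀ {n₁ n₂ n₃ n₄} (g₃ : Inj n₃ n₄) (g₂ : Inj n₂ n₃) (g₁ : Inj n₁ n₂) x →
           act g₃ (act g₂ (act g₁ x)) ≈ act ((g₃ ∘ᵢ g₂) ∘ᵢ g₁) x
  act-∘₃ g₃ g₂ g₁ x = S.sym (S.trans (act-∘ _ g₁ x) (act-∘ g₃ g₂ _))

  act-substᵢ : ∀ {n m} (p : n ≡ m) (x : RFam.C R n) → act (substᵢ p) x ≈ subst (RFam.C R) p x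
  act-substᵢ refl x = act-id x

  act-⊕-∘ : ∀ {a b c d} (g : Inj c d) (f : Inj b c) (x : RFam.C R (b + a)) →
            act ((g ∘ᵢ f) ⊕ idInj {a}) x ≈ act (g ⊕ idInj {a}) (act (f ⊕ idInj) x)
  act-⊕-∘ g f x = act-≗∘ (g ⊕ idInj) (f ⊕ idInj) (λ k → sym (⊕-∘ g idInj f idInj k)) x

  ≈⇒TEq : ∀ {a c} {y y' : RFam.C R (c + a)} → y ≈ y' → TEq R a (c , y) (c , y')
  ≈⇒TEq {a} {c} {y} y≈y' =
    fwd (idInj , act≈⇒Act (idInj {c} ⊕ idInj {a})
                   (S.trans (act-ext (⊕-id {c} {a}) y) (S.trans (act-id y) y≈y'))) ◅ ε

  renaming⇒TEq : ∀ {a c c'} (f : Inj c c') {y : RFam.C R (c + a)} {y'} →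
                 act (f ⊕ idInj {a}) y ≈ y' → TEq R a (c , y) (c' , y')
  renaming⇒TEq f e = fwd (f , act≈⇒Act _ e) ◅ ε

  Cospan : ∀ a → TCar R a → TCar R a → Set
  Cospan a (b , w) (b' , w') = Σ ℕ λ c → Σ (Inj b c) λ f → Σ (Inj b' c) λ f' →
                               act (f ⊕ idInj {a}) w ≈ act (f' ⊕ idInj {a}) w'

  cospan⇒TEq : ∀ {a} {t t' : TCar R a} → Cospan a t t' → TEq R a t t'
  cospan⇒TEq (c , f , f' , e) = fwd (f , act≈⇒Act _ S.refl) ◅ bwd (f' , act≈⇒Act _ (S.sym e)) ◅ ε

  private
    cospan-refl : ∀ {a} (t : TCar R a) → Cospan a t t
    cospan-refl (b , w) = b , idInj , idInj , S.refl

    cospan-sym : ∀ {a} {t t' : TCar R a} → Cospan a t t' → Cospan a t' t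
    cospan-sym (c , f , f' , e) = c , f' , f , S.sym e

    cospan-trans : ∀ {a} {t t' t'' : TCar R a} → Cospan a t t' → Cospan a t' t'' → Cospan a t t''
    cospan-trans {a} {b₁ , w₁} {b₂ , w₂} {b₃ , w₃} (c₁ , f₁ , f₂ , e₁) (c₂ , g₂ , g₃ , e₂) =
      c₁ + c₂ , amalg ∘ᵢ f₁ , inrᵢ c₁ ∘ᵢ g₃ ,
      S.trans (act-⊕-∘ amalg f₁ w₁)
      (S.trans (act-cong _ e₁)
      (S.trans (S.sym (act-⊕-∘ amalg f₂ w₂))
      (S.trans (act-ext (⊕-cong {b₂} {a = a} {g = amalg ∘ᵢ f₂} {g' = inrᵢ c₁ ∘ᵢ g₂}
                          {h = idInj {a}} {h' = idInj {a}} amalg-image (λ _ → refl)) w₂)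
      (S.trans (act-⊕-∘ (inrᵢ c₁) g₂ w₂)
      (S.trans (act-cong _ e₂)
      (S.sym (act-⊕-∘ (inrᵢ c₁) g₃ w₃)))))))
      where open Amalgamation f₂ g₂

    cospan-TGen : ∀ {a} {t t' : TCar R a} → TGen R a t t' → Cospan a t t'
    cospan-TGen {a} {b , w} {b' , w'} (f , r) = b' , f , idInj ,
      S.trans (Act⇒act≈ _ r) (S.sym (S.trans (act-ext (⊕-id {b'} {a}) w') (act-id w')))

  abstract
    TEq⇒cospan : ∀ {a} {t t' : TCar R a} → TEq R a t t' → Cospan a t t'
    TEq⇒cospan ε = cospan-refl _
    TEq⇒cospan (fwd g ◅ rest) = cospan-trans (cospan-TGen g) (TEq⇒cospan rest)
    TEq⇒cospan (bwd g ◅ rest) = cospan-trans (cospan-sym (cospan-TGen g)) (TEq⇒cospan rest)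

module _ {R : RFam} (ρ : IsFunctorial R) where
  private module F = Functorial ρ

  actT : ∀ {a a'} → Inj a a' → TCar R a → TCar R a'
  actT g (c , y) = c , F.act (idInj {c} ⊕ g) y

  private
    actT-TGen : ∀ {a a'} (g : Inj a a') {t t' : TCar R a} →
                TGen R a t t' → TGen R a' (actT g t) (actT g t')
    actT-TGen g {c , y} (f , r) = f , F.act≈⇒Act _
      (F.S.trans (F.act-square (f ⊕ idInj) (idInj ⊕ g) (idInj ⊕ g) (f ⊕ idInj) (⊕-interchange f g) y)
                 (F.act-cong (idInj ⊕ g) (F.Act⇒act≈ _ r)))

  T-functorial : IsFunctorial (T R)
  T-functorial = record
    { act = actT
    ; act-cong = λ g → EqC.gmap (actT g) (actT-TGen g)
    ; act-ext = λ { {a} {_} {f} {g} f≗g (c , y) →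
        F.≈⇒TEq (F.act-ext (⊕-cong {c} {a = a} {g = idInj {c}} {g' = idInj {c}} {h = f} {h' = g}
                              (λ _ → refl) f≗g) y) }
    ; act-id = λ { {a} (c , y) → F.≈⇒TEq (F.S.trans (F.act-ext (⊕-id {c} {a}) y) (F.act-id y)) }
    ; act-∘ = λ { g f (c , y) →
        F.≈⇒TEq (F.act-≗∘ (idInj ⊕ g) (idInj ⊕ f) (λ k → sym (⊕-∘ (idInj {c}) g (idInj {c}) f k)) y) }
    ; Act⇒act≈ = λ { f (y'' , r , t≈t') → F.≈⇒TEq (F.Act⇒act≈ _ r) ◅◅ t≈t' }
    ; act≈⇒Act = λ { f {c , y} t≈t' → F.act (idInj ⊕ f) y , F.act≈⇒Act _ F.S.refl , t≈t' }
    }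

module _ {R : RFam} (ρ : IsFunctorial R) where
  private
    module F = Functorial ρ
    module TF = Functorial (T-functorial ρ)
    module TTF = Functorial (T-functorial (T-functorial ρ))

  abstract
    thunkable-act : ∀ {a a'} (g : Inj a a') (t : TCar R a) → Thunkable R t → Thunkable R (actT ρ g t)
    thunkable-act {a} g (b , y) th =
      EqC.symmetric _ (TF.≈⇒TEq (F.≈⇒TEq (F.act-ext
        (⊕-cong {b} {a = a} {g = idInj {b}} {g' = idInj {b}} {h = g} {h' = idInj {0} ⊕ g}
                (λ _ → refl) (λ _ → refl)) y)))
      ◅◅ TTF.act-cong g th
      ◅◅ TF.≈⇒TEq (F.≈⇒TEq (F.act-ext {f = idInj {0} ⊕ (idInj {b} ⊕ g)} {g = idInj {b} ⊕ g}
                                       (λ _ → refl) y))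

  private
    actD : ∀ {a a'} → Inj a a' → RFam.C (D R) a → RFam.C (D R) a'
    actD g (t , th) = actT ρ g t , thunkable-act g t th

  D-functorial : IsFunctorial (D R)
  D-functorial = record
    { act = actD
    ; act-cong = λ g → TF.act-cong g
    ; act-ext = λ f≗g d → TF.act-ext f≗g (proj₁ d)
    ; act-id = λ d → TF.act-id (proj₁ d)
    ; act-∘ = λ g f d → TF.act-∘ g f (proj₁ d)
    ; Act⇒act≈ = λ f → TF.Act⇒act≈ f
    ; act≈⇒Act = λ f → TF.act≈⇒Act f
    }

module Thunkability {R : RFam} (ρ : IsFunctorial R) where
  private
    module F = Functorial ρ
    module TF = Functorial (T-functorial ρ)
  open F using (act; _≈_)

  η-TGen : ∀ {a} {t t' : TCar R a} → TGen R a t t' → TGen (T R) a (Tη R t) (Tη R t')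
  η-TGen {a} {n , y} (f , r) =
    f , TF.act≈⇒Act (f ⊕ idInj {a}) (F.≈⇒TEq (F.S.trans (F.act-ext (λ _ → refl) y) (F.Act⇒act≈ _ r)))

  Tη-cong : ∀ {a} {t t' : TCar R a} → TEq R a t t' → TEq (T R) a (Tη R t) (Tη R t')
  Tη-cong = EqC.gmap (Tη R) η-TGen

  Thunkable-resp : ∀ {a} {t t' : TCar R a} → TEq R a t t' → Thunkable R t → Thunkable R t'
  Thunkable-resp t≈t' th = EqC.symmetric _ (TF.≈⇒TEq t≈t') ◅◅ th ◅◅ Tη-cong t≈t'

  -- Thunkability of [b , w] with both cospans unfolded: w becomes the same element
  -- whether its b fresh names are sent into the block C (by k₁) or into B (by f₂).
  ThunkableWitness : ∀ a b → RFam.C R (b + a) → Set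
  ThunkableWitness a b w =
    Σ ℕ λ B → Σ (Inj 0 B) λ f₁ → Σ (Inj b B) λ f₂ →
    Σ ℕ λ C → Σ (Inj b C) λ k₁ → Σ (Inj 0 C) λ k₂ →
    act (k₁ ⊕ idInj) (act (idInj {b} ⊕ (f₁ ⊕ idInj {a})) w)
      ≈ act (k₂ ⊕ idInj) (act (idInj {0} ⊕ (f₂ ⊕ idInj {a})) w)

  thunkable⇒witness : ∀ {a b} {w : RFam.C R (b + a)} → Thunkable R (b , w) → ThunkableWitness a b w
  thunkable⇒witness th with TF.TEq⇒cospan th
  ... | (B , f₁ , f₂ , inner) with F.TEq⇒cospan inner
  ... | (C , k₁ , k₂ , e) = B , f₁ , f₂ , C , k₁ , k₂ , e

  witness⇒thunkable : ∀ {a b} {w : RFam.C R (b + a)} → ThunkableWitness a b w → Thunkable R (b , w)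
  witness⇒thunkable (B , f₁ , f₂ , C , k₁ , k₂ , e) =
    TF.cospan⇒TEq (B , f₁ , f₂ , F.cospan⇒TEq (C , k₁ , k₂ , e))

pointwise⇒IsPullbackInj : ∀ {a b c d} (f : Inj a c) (g : Inj b c) (p : Inj d a) (q : Inj d b) →
  (f ∘ᵢ p) ≗ᵢ (g ∘ᵢ q) →
  (∀ i j → fun f i ≡ fun g j → Σ (Fin d) λ k → fun p k ≡ i) →
  IsPullbackInj f g p q
pointwise⇒IsPullbackInj {a} {b} {c} {d} f g p q commutes point = commutes , mediate
  where
  mediate : ∀ {e} (p' : Inj e a) (q' : Inj e b) → (f ∘ᵢ p') ≗ᵢ (g ∘ᵢ q') →
            Σ (Inj e d) λ u → ((p ∘ᵢ u) ≗ᵢ p') × ((q ∘ᵢ u) ≗ᵢ q')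
              × (∀ (u' : Inj e d) → (p ∘ᵢ u') ≗ᵢ p' → (q ∘ᵢ u') ≗ᵢ q' → u' ≗ᵢ u)
  mediate {e} p' q' commutes' = u , p∘u≗p' , q∘u≗q' , unique
    where
    w : ∀ i → Σ (Fin d) λ k → fun p k ≡ fun p' i
    w i = point (fun p' i) (fun q' i) (commutes' i)
    u : Inj e d
    u = mkInj (λ i → proj₁ (w i))
              (λ {i} {j} eq → inj p' (trans (sym (proj₂ (w i))) (trans (cong (fun p) eq) (proj₂ (w j)))))
    p∘u≗p' : (p ∘ᵢ u) ≗ᵢ p'
    p∘u≗p' i = proj₂ (w i)
    q∘u≗q' : (q ∘ᵢ u) ≗ᵢ q'
    q∘u≗q' i = inj g (trans (sym (commutes (proj₁ (w i)))) (trans (cong (fun f) (proj₂ (w i))) (commutes' i)))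
    unique : ∀ u' → (p ∘ᵢ u') ≗ᵢ p' → (q ∘ᵢ u') ≗ᵢ q' → u' ≗ᵢ u
    unique u' p∘u'≗p' _ i = inj p (trans (p∘u'≗p' i) (sym (proj₂ (w i))))

IsPullbackInj⇒pointwise : ∀ {a b c d} {f : Inj a c} {g : Inj b c} {p : Inj d a} {q : Inj d b} →
  IsPullbackInj f g p q → ∀ i j → fun f i ≡ fun g j → Σ (Fin d) λ k → fun p k ≡ i
IsPullbackInj⇒pointwise (_ , mediate) i j fi≡gj
  with mediate {1} (mkInj (λ _ → i) (λ { {zero} {zero} _ → refl }))
                   (mkInj (λ _ → j) (λ { {zero} {zero} _ → refl })) (λ _ → fi≡gj)
... | (u , p∘u≗i , _) = fun u zero , p∘u≗i zero

-- toContext moves the names in the image of p into the context d.  Given f x = g y, the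
-- element [a , toContext x] ∈ T X d is thunkable: its two renamings factor through f as
-- h₁ ∘ f and h₂ ∘ f, and h₁, h₂ agree on the image of g because the square is a pullback.
module PullbackRenaming {a b c d} (f : Inj a c) (g : Inj b c) (p : Inj d a)
         (point : ∀ i j → fun f i ≡ fun g j → Σ (Fin d) λ k → fun p k ≡ i) where
  module P = Amalgamation p (idInj {d})

  toContext : Inj a (a + d)
  toContext = P.amalg

  private
    module H₁ = Amalgamation (f ∘ᵢ p) (inrᵢ c {d})
    module H₂ = Amalgamation f ((f ⊕ idInj {d}) ∘ᵢ toContext)

  h₁ h₂ : Inj c (c + (c + d))
  h₁ = H₁.amalg
  h₂ = H₂.amalg

  h₁∘f-factors : (h₁ ∘ᵢ f) ≗ᵢ (((f ⊕ idInj {c + d}) ∘ᵢ (idInj {a} ⊕ (!ᵢ {c} ⊕ idInj {d}))) ∘ᵢ toContext)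
  h₁∘f-factors i = by-image i (P.image? i)
    where
    by-image : ∀ i → Dec (Σ (Fin d) λ k → fun p k ≡ i) →
               fun (h₁ ∘ᵢ f) i ≡ fun (((f ⊕ idInj {c + d}) ∘ᵢ (idInj {a} ⊕ (!ᵢ {c} ⊕ idInj {d}))) ∘ᵢ toContext) i
    by-image .(fun p k) (yes (k , refl)) =
      trans (H₁.amalg-image k)
        (sym (trans (cong (λ z → fun (f ⊕ idInj {c + d}) (fun (idInj {a} ⊕ (!ᵢ {c} ⊕ idInj {d})) z))
                          (P.amalg-image k))
             (trans (cong (fun (f ⊕ idInj {c + d})) (⊕-↑ʳ (idInj {a}) (!ᵢ {c} ⊕ idInj {d}) k))
                    (⊕-↑ʳ f (idInj {c + d}) _))))
    by-image i (no ∉image) =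
      trans (H₁.amalg-outside (fun f i) (λ k eq → ∉image (k , inj f eq)))
        (sym (trans (cong (λ z → fun (f ⊕ idInj {c + d}) (fun (idInj {a} ⊕ (!ᵢ {c} ⊕ idInj {d})) z))
                          (P.amalg-outside i (λ k eq → ∉image (k , eq))))
             (trans (cong (fun (f ⊕ idInj {c + d})) (⊕-↑ˡ (idInj {a}) (!ᵢ {c} ⊕ idInj {d}) i))
                    (⊕-↑ˡ f (idInj {c + d}) i))))

  h₂∘f-factors : (h₂ ∘ᵢ f) ≗ᵢ (((!ᵢ {c} ⊕ idInj {c + d}) ∘ᵢ (idInj {0} ⊕ (f ⊕ idInj {d}))) ∘ᵢ toContext)
  h₂∘f-factors = H₂.amalg-image

  h₁∘g≗h₂∘g : (h₁ ∘ᵢ g) ≗ᵢ (h₂ ∘ᵢ g)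
  h₁∘g≗h₂∘g j = by-image (H₁.image? (fun g j))
    where
    by-image : Dec (Σ (Fin d) λ k → fun (f ∘ᵢ p) k ≡ fun g j) → fun (h₁ ∘ᵢ g) j ≡ fun (h₂ ∘ᵢ g) j
    by-image (yes (k , fpk≡gj)) =
      trans (cong (fun h₁) (sym fpk≡gj))
        (trans (H₁.amalg-image k)
          (sym (trans (cong (fun h₂) (sym fpk≡gj))
                 (trans (H₂.amalg-image (fun p k))
                   (cong (c ↑ʳ_) (trans (cong (fun (f ⊕ idInj {d})) (P.amalg-image k))
                                        (⊕-↑ʳ f (idInj {d}) k)))))))
    by-image (no ∉image) =
      trans (H₁.amalg-outside (fun g j) (λ k eq → ∉image (k , eq)))
        (sym (H₂.amalg-outside (fun g j) (λ i eq → let (k , pk≡i) = point i j eq in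
                                                   ∉image (k , trans (cong (fun f) pk≡i) eq))))

module Sobriety (X : Functor) where
  private
    ρ : IsFunctorial (toR X)
    ρ = functor-isFunctorial X
    module F = Functorial ρ
    module S {a} = Setoid (Functor.Obj X a)
  open F using (act; _≈_)
  open Thunkability ρ

  nominal⇒act-injective : Nominal X → ∀ {a c} (f : Inj a c) {x y} → act f x ≈ act f y → x ≈ y
  -- f is injective, so (idInj , idInj) is its kernel pair.
  nominal⇒act-injective nominal f {x} {y} fx≈fy
    with proj₂ (nominal f f idInj idInj
                  (pointwise⇒IsPullbackInj f f idInj idInj (λ _ → refl) (λ i _ _ → i , refl)))
               x y fx≈fy
  ... | (z , z≈x , z≈y , _) = S.trans (S.sym z≈x) z≈y

  nominal⇒supported : Nominal X → ∀ {a} b (w : Functor.C X (b + a)) → ThunkableWitness a b w →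
                      Σ (Functor.C X a) λ z → act (inrᵢ b) z ≈ w
  nominal⇒supported nominal {a} b w (B , f₁ , f₂ , C , k₁ , k₂ , e) =
    let (z , inr-z≈w , _) = proj₂ (nominal α β (inrᵢ b) (inrᵢ b)
                                    (pointwise⇒IsPullbackInj α β (inrᵢ b) (inrᵢ b) α∘inr≗β∘inr α-meets-β-in-a))
                                 w w (S.trans (F.act-∘ _ _ w) (S.trans e (S.sym (F.act-∘ _ _ w))))
    in z , inr-z≈w
    where
    α β : Inj (b + a) (C + (B + a))
    α = (k₁ ⊕ idInj) ∘ᵢ (idInj {b} ⊕ (f₁ ⊕ idInj {a}))
    β = (k₂ ⊕ idInj) ∘ᵢ (idInj {0} ⊕ (f₂ ⊕ idInj {a}))
    α∘inr≗β∘inr : (α ∘ᵢ inrᵢ b) ≗ᵢ (β ∘ᵢ inrᵢ b)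
    α∘inr≗β∘inr j =
      trans (cong (fun (k₁ ⊕ idInj)) (⊕-↑ʳ (idInj {b}) (f₁ ⊕ idInj {a}) j))
        (trans (⊕-↑ʳ k₁ (idInj {B + a}) _) (sym (cong (C ↑ʳ_) (⊕-↑ʳ f₂ (idInj {a}) j))))
    α-meets-β-in-a : ∀ i j → fun α i ≡ fun β j → Σ (Fin a) λ k → b ↑ʳ k ≡ i
    α-meets-β-in-a i j αi≡βj with ↑-view b a i
    ... | inj₁ (l , refl) = ⊥-elim (↑ˡ≢↑ʳ _ _ (trans (sym (trans
            (cong (fun (k₁ ⊕ idInj)) (⊕-↑ˡ (idInj {b}) (f₁ ⊕ idInj {a}) l))
            (⊕-↑ˡ k₁ (idInj {B + a}) l))) αi≡βj))
    ... | inj₂ (k , refl) = k , refl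

  nominal⇒sober : Nominal X → Sober X
  nominal⇒sober nominal = η-injective , thunkable⇒η
    where
    η-injective : ∀ {a} (x y : Functor.C X a) → TEq (toR X) a (0 , x) (0 , y) → x ≈ y
    η-injective x y ηx≈ηy with F.TEq⇒cospan ηx≈ηy
    ... | (c , _ , _ , e) = nominal⇒act-injective nominal (inrᵢ c)
            (S.trans (F.act-ext (λ _ → refl) x) (S.trans e (F.act-ext (λ _ → refl) y)))

    thunkable⇒η : ∀ {a} (t : TCar (toR X) a) → Thunkable (toR X) t →
                  Σ (Functor.C X a) λ x → TEq (toR X) a (0 , x) t
    thunkable⇒η (b , w) th = z , F.renaming⇒TEq !ᵢ (S.trans (F.act-ext (λ _ → refl) z) z↦w)
      where open Σ (nominal⇒supported nominal b w (thunkable⇒witness th)) renaming (proj₁ to z; proj₂ to z↦w)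

  sober⇒act-injective : Sober X → ∀ {a c} (f : Inj a c) {x y} → act f x ≈ act f y → x ≈ y
  sober⇒act-injective (η-injective , _) {a} {c} f {x} {y} fx≈fy =
    η-injective x y (F.cospan⇒TEq (c , !ᵢ , !ᵢ ,
      S.trans (F.act-≗∘ amalg f inr≗amalg∘f x)
        (S.trans (F.act-cong amalg fx≈fy) (S.sym (F.act-≗∘ amalg f inr≗amalg∘f y)))))
    where
    open Amalgamation f (idInj {a})
    inr≗amalg∘f : (!ᵢ {c} ⊕ idInj {a}) ≗ᵢ (amalg ∘ᵢ f)
    inr≗amalg∘f i = sym (amalg-image i)

  module _ (sober : Sober X) {a b c d} {f : Inj a c} {g : Inj b c} {p : Inj d a} {q : Inj d b}
           (pullback : IsPullbackInj f g p q) where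
    open PullbackRenaming f g p (IsPullbackInj⇒pointwise {f = f} {g} {p} {q} pullback)

    toContext-thunkable : ∀ {x y} → act f x ≈ act g y → Thunkable (toR X) (a , act toContext x)
    toContext-thunkable {x} {y} fx≈gy = witness⇒thunkable (c , !ᵢ , f , c , f , !ᵢ ,
      S.trans (S.sym (F.act-∘ _ _ _))
      (S.trans (F.act-square _ toContext h₁ f (λ i → sym (h₁∘f-factors i)) x)
      (S.trans (F.act-cong h₁ fx≈gy)
      (S.trans (F.act-square h₁ g h₂ g h₁∘g≗h₂∘g y)
      (S.trans (F.act-cong h₂ (S.sym fx≈gy))
      (S.trans (F.act-square h₂ f _ toContext h₂∘f-factors x)
      (F.act-∘ _ _ _)))))))

    cospan⇒p-preimage : ∀ {x z} → F.Cospan d (0 , z) (a , act toContext x) → act p z ≈ x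
    cospan⇒p-preimage {x} {z} (c' , g₁ , g₂ , e) =
      sober⇒act-injective sober ψ (S.trans (S.sym (F.act-≗∘ ψ p g₁⊕id≗ψ∘p z)) (S.trans e (S.sym (F.act-∘ _ _ x))))
      where
      ψ : Inj a (c' + d)
      ψ = (g₂ ⊕ idInj {d}) ∘ᵢ toContext
      g₁⊕id≗ψ∘p : (g₁ ⊕ idInj {d}) ≗ᵢ (ψ ∘ᵢ p)
      g₁⊕id≗ψ∘p k = sym (trans (cong (fun (g₂ ⊕ idInj {d})) (P.amalg-image k)) (⊕-↑ʳ g₂ (idInj {d}) k))

    p-preimage : ∀ {x y} → act f x ≈ act g y → Σ (Functor.C X d) λ z → act p z ≈ x
    p-preimage {x} fx≈gy = z , cospan⇒p-preimage (F.TEq⇒cospan ηz≈t)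
      where open Σ (proj₂ sober (a , act toContext x) (toContext-thunkable fx≈gy))
                     renaming (proj₁ to z; proj₂ to ηz≈t)

  sober⇒nominal : Sober X → Nominal X
  sober⇒nominal sober {a} {b} {c} {d} f g p q pullback = F.act-square f p g q (proj₁ pullback) , mediate
    where
    mediate : ∀ (x : Functor.C X a) (y : Functor.C X b) → act f x ≈ act g y →
              Σ (Functor.C X d) λ z → (act p z ≈ x) × (act q z ≈ y)
                × (∀ (z' : Functor.C X d) → act p z' ≈ x → act q z' ≈ y → z' ≈ z)
    mediate x y fx≈gy =
      z , pz≈x ,
      sober⇒act-injective sober g
        (S.trans (S.sym (F.act-square f p g q (proj₁ pullback) z)) (S.trans (F.act-cong f pz≈x) fx≈gy)) ,
      λ z' pz'≈x _ → sober⇒act-injective sober p (S.trans pz'≈x (S.sym pz≈x))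
      where open Σ (p-preimage sober {f = f} {g} {p} {q} pullback fx≈gy) renaming (proj₁ to z; proj₂ to pz≈x)

module Rebinding {a b c B C : ℕ} (f₁ : Inj 0 B) (f₂ : Inj c B) (h₁ : Inj c C) (h₂ : Inj 0 C) where
  private
    n ctx : ℕ
    n = b + a
    ctx = (c + b) + a
    module W = Amalgamation (f₂ ⊕ idInj {n}) (+-assocᵢ c b a)
    open ≡-Reasoning

  E : ℕ
  E = C + (B + n)

  -- The names that f₂ put into B are identified with the block c of the context.
  rebind : Inj E (E + ctx)
  rebind = +-assocᵢ C (B + n) ctx ∘ᵢ (idInj {C} ⊕ W.amalg)

  G₁ G₂ : Inj (c + n) E
  G₁ = (h₁ ⊕ idInj {B + n}) ∘ᵢ (idInj {c} ⊕ (f₁ ⊕ idInj {n}))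
  G₂ = (h₂ ⊕ idInj {B + n}) ∘ᵢ (idInj {0} ⊕ (f₂ ⊕ idInj {n}))

  rebind-square₁ : (((inlᵢ (B + n) ∘ᵢ h₁) ⊕ idInj {ctx}) ∘ᵢ (idInj {c} ⊕ (inrᵢ c ⊕ idInj {a})))
                   ≗ᵢ (rebind ∘ᵢ G₁)
  rebind-square₁ = ↑-ext {c} {n} _ _
    (λ i → begin
       fun ((inlᵢ (B + n) ∘ᵢ h₁) ⊕ idInj {ctx}) (fun (idInj {c} ⊕ (inrᵢ c ⊕ idInj {a})) (i ↑ˡ n))
         ≡⟨ cong (fun ((inlᵢ (B + n) ∘ᵢ h₁) ⊕ idInj {ctx})) (⊕-↑ˡ (idInj {c}) (inrᵢ c ⊕ idInj {a}) i) ⟩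
       fun ((inlᵢ (B + n) ∘ᵢ h₁) ⊕ idInj {ctx}) (i ↑ˡ ctx)
         ≡⟨ ⊕-↑ˡ (inlᵢ (B + n) ∘ᵢ h₁) (idInj {ctx}) i ⟩
       (fun h₁ i ↑ˡ (B + n)) ↑ˡ ctx
         ≡⟨ +-assocᵢ-↑ˡ C (B + n) ctx (fun h₁ i) ⟨
       fun (+-assocᵢ C (B + n) ctx) (fun h₁ i ↑ˡ ((B + n) + ctx))
         ≡⟨ cong (fun (+-assocᵢ C (B + n) ctx)) (⊕-↑ˡ (idInj {C}) W.amalg (fun h₁ i)) ⟨
       fun rebind (fun h₁ i ↑ˡ (B + n))
         ≡⟨ cong (fun rebind) (⊕-↑ˡ h₁ (idInj {B + n}) i) ⟨
       fun rebind (fun (h₁ ⊕ idInj {B + n}) (i ↑ˡ (B + n)))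
         ≡⟨ cong (λ z → fun rebind (fun (h₁ ⊕ idInj {B + n}) z)) (⊕-↑ˡ (idInj {c}) (f₁ ⊕ idInj {n}) i) ⟨
       fun (rebind ∘ᵢ G₁) (i ↑ˡ n) ∎)
    (λ j → begin
       fun ((inlᵢ (B + n) ∘ᵢ h₁) ⊕ idInj {ctx}) (fun (idInj {c} ⊕ (inrᵢ c ⊕ idInj {a})) (c ↑ʳ j))
         ≡⟨ cong (fun ((inlᵢ (B + n) ∘ᵢ h₁) ⊕ idInj {ctx})) (⊕-↑ʳ (idInj {c}) (inrᵢ c ⊕ idInj {a}) j) ⟩
       fun ((inlᵢ (B + n) ∘ᵢ h₁) ⊕ idInj {ctx}) (c ↑ʳ fun (inrᵢ c ⊕ idInj {a}) j)
         ≡⟨ ⊕-↑ʳ (inlᵢ (B + n) ∘ᵢ h₁) (idInj {ctx}) _ ⟩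
       E ↑ʳ fun (inrᵢ c ⊕ idInj {a}) j
         ≡⟨ cong (E ↑ʳ_) (+-assocᵢ-↑ʳ c b a j) ⟨
       E ↑ʳ fun (+-assocᵢ c b a) (c ↑ʳ j)
         ≡⟨ +-assocᵢ-↑ʳ↑ʳ C (B + n) ctx _ ⟨
       fun (+-assocᵢ C (B + n) ctx) (C ↑ʳ ((B + n) ↑ʳ fun (+-assocᵢ c b a) (c ↑ʳ j)))
         ≡⟨ cong (λ z → fun (+-assocᵢ C (B + n) ctx) (C ↑ʳ z)) (W.amalg-image (c ↑ʳ j)) ⟨
       fun (+-assocᵢ C (B + n) ctx) (C ↑ʳ fun W.amalg (fun (f₂ ⊕ idInj {n}) (c ↑ʳ j)))
         ≡⟨ cong (λ z → fun (+-assocᵢ C (B + n) ctx) (C ↑ʳ fun W.amalg z)) (⊕-↑ʳ f₂ (idInj {n}) j) ⟩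
       fun (+-assocᵢ C (B + n) ctx) (C ↑ʳ fun W.amalg (B ↑ʳ j))
         ≡⟨ cong (fun (+-assocᵢ C (B + n) ctx)) (⊕-↑ʳ (idInj {C}) W.amalg _) ⟨
       fun rebind (C ↑ʳ (B ↑ʳ j))
         ≡⟨ cong (fun rebind) (⊕-↑ʳ h₁ (idInj {B + n}) _) ⟨
       fun rebind (fun (h₁ ⊕ idInj {B + n}) (c ↑ʳ (B ↑ʳ j)))
         ≡⟨ cong (λ z → fun rebind (fun (h₁ ⊕ idInj {B + n}) z)) (⊕-↑ʳ (idInj {c}) (f₁ ⊕ idInj {n}) j) ⟨
       fun (rebind ∘ᵢ G₁) (c ↑ʳ j) ∎)

  rebind-square₂ : (rebind ∘ᵢ G₂) ≗ᵢ ((!ᵢ {E} ⊕ idInj {ctx}) ∘ᵢ +-assocᵢ c b a)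
  rebind-square₂ k = begin
    fun (+-assocᵢ C (B + n) ctx) (fun (idInj {C} ⊕ W.amalg) (C ↑ʳ fun (f₂ ⊕ idInj {n}) k))
      ≡⟨ cong (fun (+-assocᵢ C (B + n) ctx)) (⊕-↑ʳ (idInj {C}) W.amalg _) ⟩
    fun (+-assocᵢ C (B + n) ctx) (C ↑ʳ fun W.amalg (fun (f₂ ⊕ idInj {n}) k))
      ≡⟨ cong (λ z → fun (+-assocᵢ C (B + n) ctx) (C ↑ʳ z)) (W.amalg-image k) ⟩
    fun (+-assocᵢ C (B + n) ctx) (C ↑ʳ ((B + n) ↑ʳ fun (+-assocᵢ c b a) k))
      ≡⟨ +-assocᵢ-↑ʳ↑ʳ C (B + n) ctx _ ⟩
    E ↑ʳ fun (+-assocᵢ c b a) k ∎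

module Idempotence {R : RFam} (ρ : IsFunctorial R) where
  private
    module F = Functorial ρ
    module TF = Functorial (T-functorial ρ)
    module S {a} = Setoid (RFam.Obj R a)
    module DThk = Thunkability (D-functorial ρ)
  open F using (act; _≈_)
  open Thunkability ρ

  flatten : ∀ c b a → RFam.C R (c + (b + a)) → RFam.C R ((c + b) + a)
  flatten c b a = subst (RFam.C R) (sym (+-assoc c b a))

  witness⇒rebind : ∀ {a b c} (x : RFam.C R (c + (b + a))) → ThunkableWitness (b + a) c x →
    TEq R ((c + b) + a) (c , act (idInj {c} ⊕ (inrᵢ c ⊕ idInj {a})) x) (0 , flatten c b a x)
  witness⇒rebind {a} {b} {c} x (B , f₁ , f₂ , C , h₁ , h₂ , e) =
    F.cospan⇒TEq (E , inlᵢ (B + (b + a)) ∘ᵢ h₁ , !ᵢ ,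
      S.trans (F.act-square _ _ rebind G₁ rebind-square₁ x)
      (S.trans (F.act-cong rebind (S.trans (F.act-∘ _ _ x) (S.trans e (S.sym (F.act-∘ _ _ x)))))
      (S.trans (F.act-square rebind G₂ _ _ rebind-square₂ x)
      (F.act-cong (!ᵢ ⊕ idInj) (F.act-substᵢ _ x)))))
    where open Rebinding {a} {b} {c} f₁ f₂ h₁ h₂

  -- The fresh names of a thunkable inner element can be bound at the outer level.
  TD-flatten : ∀ {a b c} (x : RFam.C R (c + (b + a))) (th : Thunkable R (c , x)) →
               TEq (D R) a (b , ((c , x) , th)) (c + b , e R (flatten c b a x))
  TD-flatten {a} {b} {c} x th =
    fwd (inrᵢ c , TF.act≈⇒Act (inrᵢ c ⊕ idInj {a}) (witness⇒rebind x (thunkable⇒witness th))) ◅ ε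

  Te : ∀ {a} → TCar R a → TCar (D R) a
  Te (n , y) = n , e R y

  Te-cong : ∀ {a} {t t' : TCar R a} → TEq R a t t' → TEq (D R) a (Te t) (Te t')
  Te-cong = EqC.gmap Te (λ {t} {t'} → η-TGen {t = t} {t'})

  e-thunkable⇒thunkable : ∀ {a} P (x : RFam.C R (P + a)) →
                          Thunkable (D R) (P , e R x) → Thunkable R (P , x)
  e-thunkable⇒thunkable {a} P x th = from-witness (DThk.thunkable⇒witness th)
    where
    from-witness : DThk.ThunkableWitness a P (e R x) → Thunkable R (P , x)
    from-witness (B , f₁ , f₂ , C , k₁ , k₂ , ηe) = from-cospan (F.TEq⇒cospan ηe)
      where
      collapse : ∀ {E Q} (k : Inj Q C) (e' : Inj 0 E) (g : Inj (P + a) (Q + (B + a))) →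
                 act (+-assocᵢ E C (B + a)) (act (e' ⊕ idInj) (act (idInj {0} ⊕ (k ⊕ idInj)) (act (idInj {0} ⊕ g) x)))
                   ≈ act ((inrᵢ E ∘ᵢ k) ⊕ idInj) (act g x)
      collapse {E} {Q} k e' g =
        S.trans (F.act-cong Ψ (F.act-∘₃ _ _ _ x))
        (S.trans (S.sym (F.act-∘ Ψ _ x))
        (F.act-≗∘ _ g (λ w → ↑-ext {Q} {B + a}
           (λ v → fun Ψ (E ↑ʳ fun (k ⊕ idInj {B + a}) v)) (fun ((inrᵢ E ∘ᵢ k) ⊕ idInj {B + a}))
           (λ i → trans (cong (λ z → fun Ψ (E ↑ʳ z)) (⊕-↑ˡ k (idInj {B + a}) i))
                    (trans (+-assocᵢ-↑ʳ↑ˡ E C (B + a) (fun k i)) (sym (⊕-↑ˡ (inrᵢ E ∘ᵢ k) (idInj {B + a}) i))))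
           (λ j → trans (cong (λ z → fun Ψ (E ↑ʳ z)) (⊕-↑ʳ k (idInj {B + a}) j))
                    (trans (+-assocᵢ-↑ʳ↑ʳ E C (B + a) j) (sym (⊕-↑ʳ (inrᵢ E ∘ᵢ k) (idInj {B + a}) j))))
           (fun g w)) x))
        where
        Ψ : Inj (E + (C + (B + a))) ((E + C) + (B + a))
        Ψ = +-assocᵢ E C (B + a)

      from-cospan : F.Cospan (C + (B + a))
                      (0 , act (idInj {0} ⊕ (k₁ ⊕ idInj)) (act (idInj {0} ⊕ (idInj {P} ⊕ (f₁ ⊕ idInj {a}))) x))
                      (0 , act (idInj {0} ⊕ (k₂ ⊕ idInj)) (act (idInj {0} ⊕ (idInj {0} ⊕ (f₂ ⊕ idInj {a}))) x)) →
                    Thunkable R (P , x)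
      from-cospan (E , e₁ , e₂ , e) = witness⇒thunkable (B , f₁ , f₂ , E + C , inrᵢ E ∘ᵢ k₁ , !ᵢ ,
        S.trans (S.sym (collapse k₁ e₁ _))
        (S.trans (F.act-cong (+-assocᵢ E C (B + a)) e)
        (S.trans (collapse k₂ e₂ _)
        (F.act-ext (λ _ → refl) _))))

  μD-thunkable : ∀ {a} (s : RFam.C (D (D R)) a) → Thunkable R (μD-underlying R s)
  μD-thunkable {a} ((b , ((c , x) , th)) , ths) =
    e-thunkable⇒thunkable (c + b) (flatten c b a x) (DThk.Thunkable-resp (TD-flatten x th) ths)

  μD-injective : ∀ {a} (s s' : RFam.C (D (D R)) a) →
                 TEq R a (μD-underlying R s) (μD-underlying R s') →
                 Setoid._≈_ (RFam.Obj (D (D R)) a) s s'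
  μD-injective ((b , ((c , x) , th)) , _) ((b' , ((c' , x') , th')) , _) μs≈μs' =
    TD-flatten x th ◅◅ Te-cong μs≈μs' ◅◅ EqC.symmetric _ (TD-flatten x' th')

  μD-surjective : ∀ {a} (d : RFam.C (D R) a) →
                  Σ (RFam.C (D (D R)) a) λ s → TEq R a (μD-underlying R s) (θ R d)
  μD-surjective {a} ((c , x) , th) = ((0 , ((c , x) , th)) , ε) ,
    EqC.symmetric _ (F.renaming⇒TEq (substᵢ (sym (+-identityʳ c)))
      (S.trans (F.act-ext (substᵢ-⊕ (sym (+-identityʳ c)) (sym (+-assoc c 0 a))) x) (F.act-substᵢ _ x)))

  D-idempotent : DIdempotentAt R
  D-idempotent a = μD-thunkable , μD-injective , μD-surjective

corollary9p7 : ((X : Functor) → Sober X ⇔ Nominal X)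
    × ((X : Functor) → DIdempotentAt (toR X))
corollary9p7 =
    (λ X → mk⇔ (Sobriety.sober⇒nominal X) (Sobriety.nominal⇒sober X))
  , (λ X → Idempotence.D-idempotent (functor-isFunctorial X))
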